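{- Let $S(q)$ be the formal power series defined in the context and $S^{(1)}(q)=\frac{S(q)-1}{q}$. Then $$S^{(1)}(q)=\cfrac{1}{1-\cfrac{q^3}{1+2q^2+\cfrac{q^5}{1+2q^2-q^3+\cfrac{q^5}{1+2q^2-\cfrac{q^3}{1+\cfrac{q^2}{1+\cfrac{q^2}{1+q+\cfrac{q^2}{1+q^2\,S^{(1)}(q)}}}}}}}}.$$
   Context: $S(q)\in\mathbb{Z}[[q]]$ is the Taylor expansion at $q=0$ of $\frac{q^3+2q-1+\sqrt{(1-q+q^2)(1+q+4q^2+q^3+q^4)}}{2q}$ (square-root branch equal to $1$ at $q=0$); equivalently, the unique formal power series satisfying $q\,S(q)^2+(1-2q-q^3)S(q)=1$. It begins $1+q+q^4-\cdots$. -}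

module Defs where

open import Data.Nat as ℕ using (ℕ; zero; suc; _∸_; _≤ᵇ_; _≡ᵇ_)
open import Data.Integer using (ℤ; +_; -_; _+_; _*_)
open import Data.Bool using (if_then_else_)
open import Relation.Binary.PropositionalEquality using (_≡_)

-- Formal power series over ℤ, represented by their coefficient sequences:
-- f n is the coefficient of q^n.
PS : Set
PS = ℕ → ℤ

infix 4 _≈_
_≈_ : PS → PS → Set
f ≈ g = ∀ n → f n ≡ g n

sum1 : ℕ → (ℕ → ℤ) → ℤ
sum1 zero    h = + 0
sum1 (suc n) h = sum1 n h + h (suc n)

sum0 : ℕ → (ℕ → ℤ) → ℤ
sum0 n h = h 0 + sum1 n h

const : ℤ → PS
const c zero    = c
const c (suc n) = + 0

𝟙 : PS
𝟙 = const (+ 1)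

qpow : ℕ → PS
qpow k n = if n ≡ᵇ k then + 1 else + 0

infixl 6 _⊕_ _⊖_
infixl 7 _⊗_

_⊕_ : PS → PS → PS
(f ⊕ g) n = f n + g n

⊝_ : PS → PS
(⊝ f) n = - f n

_⊖_ : PS → PS → PS
f ⊖ g = f ⊕ (⊝ g)

_⊗_ : PS → PS → PS
(f ⊗ g) n = sum0 n (λ j → f j * g (n ∸ j))

-- Multiplicative inverse of a series whose constant term is a unit of ℤ
-- (i.e. f 0 = ±1, so that 1/(f 0) = f 0):
--   g 0 = f 0,   g n = - f 0 * Σ_{j=1}^{n} f j * g (n - j)   (n ≥ 1).
-- invUpTo f n agrees with the inverse at all indices ≤ n.
invUpTo : PS → ℕ → PS
invUpTo f zero k = f 0
invUpTo f (suc n) k =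
  if k ≤ᵇ n then invUpTo f n k
  else - (f 0 * sum1 (suc n) (λ j → f j * invUpTo f n (suc n ∸ j)))

inv : PS → PS
inv f n = invUpTo f n n

infixl 7 _⊘_
_⊘_ : PS → PS → PS
a ⊘ b = a ⊗ inv b

-- Shift: S ↦ (S - S(0)) / q, i.e. coefficient n ↦ S (n+1).
-- For S with S(0) = 1 this is S^{(1)} = (S - 1)/q.
shift : PS → PS
shift S n = S (suc n)

-- Writing S = 1 + q x with x = S⁽¹⁾, the equation for S becomes q · m(x) = 0 with
-- m(x) = q² x² + (1 - q³) x - 1 - q², so m(x) = 0. The continued fraction equals P₀ / P₁,
-- where P₀, P₁ are its continuants: polynomials in q and x built bottom-up from the tail
-- 1 + q² x. Polynomial division gives x P₀ - P₁ = K · m(x) for an explicit K ∈ ℤ[q], so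
-- x P₀ = P₁ and the continued fraction is 1/x. All polynomial identities are checked by the
-- ring solver over ℤ[[q]], after reading the monomials q², q³, q⁵ of the statement as
-- powers of q.
module Submission where

open import Level using (0ℓ)
open import Data.Nat as ℕ using (ℕ; zero; suc; 2+; _∸_; _<ᵇ_; z≤n; s≤s)
open import Data.Fin using (Fin; zero; suc)
open import Data.Vec using (_∷_; []; lookup)
open import Algebra.Bundles using (RawRing; CommutativeRing)
open import Algebra.Solver.Ring.AlmostCommutativeRing
  using (AlmostCommutativeRing; fromCommutativeRing; _-Raw-AlmostCommutative⟶_; Induced-equivalence)
open import Relation.Binary.Definitions using (WeaklyDecidable)
import Algebra.Solver.Ring as RingSolver

module Substitution
  {r₁ r₂ r₃ r₄} {Coeff : RawRing r₁ r₄} {R : AlmostCommutativeRing r₂ r₃}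
  (morphism : Coeff -Raw-AlmostCommutative⟶ R)
  (coeff≟ : WeaklyDecidable (Induced-equivalence morphism)) where

  open RingSolver Coeff R morphism coeff≟
  open AlmostCommutativeRing R
  open import Algebra.Properties.Semiring.Exp semiring using (^-congˡ)

  private variable m n : ℕ

  _[_] : Polynomial m → (Fin m → Polynomial n) → Polynomial n
  op o p₁ p₂ [ τ ] = op o (p₁ [ τ ]) (p₂ [ τ ])
  con c      [ τ ] = con c
  var i      [ τ ] = τ i
  (p :^ k)   [ τ ] = p [ τ ] :^ k
  (:- p)     [ τ ] = :- (p [ τ ])

  ⟦⟧-[] : ∀ {τ : Fin m → Polynomial n} {ρ ρ′} → (∀ i → ⟦ τ i ⟧ ρ ≈ lookup ρ′ i) →
          ∀ p → ⟦ p [ τ ] ⟧ ρ ≈ ⟦ p ⟧ ρ′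
  ⟦⟧-[] τ≈ρ′ (op [+] p₁ p₂) = +-cong (⟦⟧-[] τ≈ρ′ p₁) (⟦⟧-[] τ≈ρ′ p₂)
  ⟦⟧-[] τ≈ρ′ (op [*] p₁ p₂) = *-cong (⟦⟧-[] τ≈ρ′ p₁) (⟦⟧-[] τ≈ρ′ p₂)
  ⟦⟧-[] τ≈ρ′ (con c)        = refl
  ⟦⟧-[] τ≈ρ′ (var i)        = τ≈ρ′ i
  ⟦⟧-[] τ≈ρ′ (p :^ k)       = ^-congˡ k (⟦⟧-[] τ≈ρ′ p)
  ⟦⟧-[] τ≈ρ′ (:- p)         = -‿cong (⟦⟧-[] τ≈ρ′ p)

open import Defs

import Data.Nat.Properties as ℕ
open import Data.Integer as ℤ using (ℤ; +_; -_; _+_; _*_)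
import Data.Integer.Properties as ℤ
open import Data.Integer.Solver using (module +-*-Solver)
open import Data.Bool using (false)
open import Data.Bool.Properties using (T-≡)
open import Data.Maybe as Maybe using ()
open import Data.Sum using (inj₁; inj₂)
open import Data.Product using (_×_; _,_)
open import Data.Unit using (⊤)
open import Function.Bundles using (Equivalence)
open import Relation.Nullary.Decidable using (dec⇒maybe)
open import Algebra.Structures using (IsCommutativeRing)
open import Relation.Binary.Structures using (IsEquivalence)
open import Relation.Binary.PropositionalEquality
  using (_≡_; refl; sym; trans; cong; cong₂; module ≡-Reasoning)
open ≡-Reasoning

-- The ring ℤ[[q]]

sum1-suc : ∀ n (h : ℕ → ℤ) → sum1 (suc n) h ≡ h 1 + sum1 n (λ j → h (suc j))
sum1-suc zero    h = trans (ℤ.+-identityˡ (h 1)) (sym (ℤ.+-identityʳ (h 1)))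
sum1-suc (suc n) h = begin
  sum1 (suc n) h + h (suc (suc n))                         ≡⟨ cong (_+ h (suc (suc n))) (sum1-suc n h) ⟩
  h 1 + sum1 n (λ j → h (suc j)) + h (suc (suc n))         ≡⟨ ℤ.+-assoc (h 1) _ _ ⟩
  h 1 + (sum1 n (λ j → h (suc j)) + h (suc (suc n)))       ∎

⊗-coeff-zero : ∀ f g → (f ⊗ g) 0 ≡ f 0 * g 0
⊗-coeff-zero f g = ℤ.+-identityʳ (f 0 * g 0)

infixr 8 _·_
_·_ : ℤ → PS → PS
(c · f) n = c * f n

shift-⊗ : ∀ f g → shift (f ⊗ g) ≈ f 0 · shift g ⊕ shift f ⊗ g
shift-⊗ f g n = cong (_+_ (f 0 * g (suc n))) (sum1-suc n _)

shift-cong : ∀ {f g} → f ≈ g → shift f ≈ shift g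
shift-cong f≈g n = f≈g (suc n)

⊗-cong : ∀ {f f′ g g′} → f ≈ f′ → g ≈ g′ → f ⊗ g ≈ f′ ⊗ g′
⊗-cong {f} {f′} {g} {g′} f≈f′ g≈g′ zero = begin
  (f ⊗ g) 0      ≡⟨ ⊗-coeff-zero f g ⟩
  f 0 * g 0      ≡⟨ cong₂ _*_ (f≈f′ 0) (g≈g′ 0) ⟩
  f′ 0 * g′ 0    ≡⟨ ⊗-coeff-zero f′ g′ ⟨
  (f′ ⊗ g′) 0    ∎
⊗-cong {f} {f′} {g} {g′} f≈f′ g≈g′ (suc n) = begin
  (f ⊗ g) (suc n)                              ≡⟨ shift-⊗ f g n ⟩
  f 0 * g (suc n) + (shift f ⊗ g) n            ≡⟨ cong₂ _+_ (cong₂ _*_ (f≈f′ 0) (g≈g′ (suc n)))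
                                                            (⊗-cong (shift-cong f≈f′) g≈g′ n) ⟩
  f′ 0 * g′ (suc n) + (shift f′ ⊗ g′) n        ≡⟨ shift-⊗ f′ g′ n ⟨
  (f′ ⊗ g′) (suc n)                            ∎

0ₚ : PS
0ₚ _ = + 0

⊗-zeroˡ : ∀ {f} → f ≈ 0ₚ → ∀ g → f ⊗ g ≈ 0ₚ
⊗-zeroˡ {f} f≈0 g zero = begin
  (f ⊗ g) 0     ≡⟨ ⊗-coeff-zero f g ⟩
  f 0 * g 0     ≡⟨ cong (_* g 0) (f≈0 0) ⟩
  + 0           ∎
⊗-zeroˡ {f} f≈0 g (suc n) = begin
  (f ⊗ g) (suc n)                        ≡⟨ shift-⊗ f g n ⟩
  f 0 * g (suc n) + (shift f ⊗ g) n      ≡⟨ cong₂ _+_ (cong (_* g (suc n)) (f≈0 0))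
                                                      (⊗-zeroˡ (shift-cong f≈0) g n) ⟩
  + 0                                    ∎

⊗-identityˡ : ∀ g → 𝟙 ⊗ g ≈ g
⊗-identityˡ g zero    = trans (⊗-coeff-zero 𝟙 g) (ℤ.*-identityˡ (g 0))
⊗-identityˡ g (suc n) = begin
  (𝟙 ⊗ g) (suc n)                        ≡⟨ shift-⊗ 𝟙 g n ⟩
  + 1 * g (suc n) + (shift 𝟙 ⊗ g) n      ≡⟨ cong₂ _+_ (ℤ.*-identityˡ (g (suc n))) (⊗-zeroˡ {shift 𝟙} (λ _ → refl) g n) ⟩
  g (suc n) + + 0                        ≡⟨ ℤ.+-identityʳ (g (suc n)) ⟩
  g (suc n)                              ∎

⊗-distribʳ : ∀ f g h → (f ⊕ g) ⊗ h ≈ f ⊗ h ⊕ g ⊗ h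
⊗-distribʳ f g h zero = begin
  ((f ⊕ g) ⊗ h) 0            ≡⟨ ⊗-coeff-zero (f ⊕ g) h ⟩
  (f 0 + g 0) * h 0          ≡⟨ ℤ.*-distribʳ-+ (h 0) (f 0) (g 0) ⟩
  f 0 * h 0 + g 0 * h 0      ≡⟨ cong₂ _+_ (⊗-coeff-zero f h) (⊗-coeff-zero g h) ⟨
  (f ⊗ h ⊕ g ⊗ h) 0          ∎
⊗-distribʳ f g h (suc n) = begin
  ((f ⊕ g) ⊗ h) (suc n)                                          ≡⟨ shift-⊗ (f ⊕ g) h n ⟩
  (f 0 + g 0) * h (suc n) + ((shift f ⊕ shift g) ⊗ h) n          ≡⟨ cong (_+_ ((f 0 + g 0) * h (suc n))) (⊗-distribʳ (shift f) (shift g) h n) ⟩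
  (f 0 + g 0) * h (suc n) + ((shift f ⊗ h) n + (shift g ⊗ h) n)  ≡⟨ regroup (f 0) (g 0) (h (suc n)) _ _ ⟩
  (f 0 * h (suc n) + (shift f ⊗ h) n)
    + (g 0 * h (suc n) + (shift g ⊗ h) n)                        ≡⟨ cong₂ _+_ (shift-⊗ f h n) (shift-⊗ g h n) ⟨
  (f ⊗ h ⊕ g ⊗ h) (suc n)                                        ∎
  where
  open +-*-Solver
  regroup : ∀ a b c u v → (a + b) * c + (u + v) ≡ (a * c + u) + (b * c + v)
  regroup = solve 5 (λ a b c u v → (a :+ b) :* c :+ (u :+ v) := (a :* c :+ u) :+ (b :* c :+ v)) refl

·-⊗-assoc : ∀ c f g → (c · f) ⊗ g ≈ c · (f ⊗ g)
·-⊗-assoc c f g zero = begin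
  ((c · f) ⊗ g) 0     ≡⟨ ⊗-coeff-zero (c · f) g ⟩
  c * f 0 * g 0       ≡⟨ ℤ.*-assoc c (f 0) (g 0) ⟩
  c * (f 0 * g 0)     ≡⟨ cong (c *_) (⊗-coeff-zero f g) ⟨
  (c · (f ⊗ g)) 0     ∎
·-⊗-assoc c f g (suc n) = begin
  ((c · f) ⊗ g) (suc n)                        ≡⟨ shift-⊗ (c · f) g n ⟩
  c * f 0 * g (suc n) + ((c · shift f) ⊗ g) n  ≡⟨ cong (_+_ (c * f 0 * g (suc n))) (·-⊗-assoc c (shift f) g n) ⟩
  c * f 0 * g (suc n) + c * (shift f ⊗ g) n    ≡⟨ factor c (f 0) (g (suc n)) _ ⟩
  c * (f 0 * g (suc n) + (shift f ⊗ g) n)      ≡⟨ cong (c *_) (shift-⊗ f g n) ⟨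
  (c · (f ⊗ g)) (suc n)                        ∎
  where
  open +-*-Solver
  factor : ∀ c a b u → c * a * b + c * u ≡ c * (a * b + u)
  factor = solve 4 (λ c a b u → c :* a :* b :+ c :* u := c :* (a :* b :+ u)) refl

⊗-assoc : ∀ f g h → (f ⊗ g) ⊗ h ≈ f ⊗ (g ⊗ h)
⊗-assoc f g h zero = begin
  ((f ⊗ g) ⊗ h) 0       ≡⟨ ⊗-coeff-zero (f ⊗ g) h ⟩
  (f ⊗ g) 0 * h 0       ≡⟨ cong (_* h 0) (⊗-coeff-zero f g) ⟩
  f 0 * g 0 * h 0       ≡⟨ ℤ.*-assoc (f 0) (g 0) (h 0) ⟩
  f 0 * (g 0 * h 0)     ≡⟨ cong (f 0 *_) (⊗-coeff-zero g h) ⟨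
  f 0 * (g ⊗ h) 0       ≡⟨ ⊗-coeff-zero f (g ⊗ h) ⟨
  (f ⊗ (g ⊗ h)) 0       ∎
⊗-assoc f g h (suc n) = begin
  ((f ⊗ g) ⊗ h) (suc n)                                  ≡⟨ shift-⊗ (f ⊗ g) h n ⟩
  (f ⊗ g) 0 * h (suc n) + (shift (f ⊗ g) ⊗ h) n          ≡⟨ cong₂ _+_ (cong (_* h (suc n)) (⊗-coeff-zero f g)) (begin
      (shift (f ⊗ g) ⊗ h) n                                    ≡⟨ ⊗-cong {g = h} (shift-⊗ f g) (λ _ → refl) n ⟩
      ((f 0 · shift g ⊕ shift f ⊗ g) ⊗ h) n                    ≡⟨ ⊗-distribʳ (f 0 · shift g) (shift f ⊗ g) h n ⟩
      ((f 0 · shift g) ⊗ h) n + ((shift f ⊗ g) ⊗ h) n          ≡⟨ cong₂ _+_ (·-⊗-assoc (f 0) (shift g) h n) (⊗-assoc (shift f) g h n) ⟩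
      f 0 * (shift g ⊗ h) n + (shift f ⊗ (g ⊗ h)) n            ∎) ⟩
  f 0 * g 0 * h (suc n) + (f 0 * (shift g ⊗ h) n + (shift f ⊗ (g ⊗ h)) n)
                                                         ≡⟨ factor (f 0) (g 0) (h (suc n)) _ _ ⟩
  f 0 * (g 0 * h (suc n) + (shift g ⊗ h) n) + (shift f ⊗ (g ⊗ h)) n
                                                         ≡⟨ cong (λ u → f 0 * u + (shift f ⊗ (g ⊗ h)) n) (shift-⊗ g h n) ⟨
  f 0 * (g ⊗ h) (suc n) + (shift f ⊗ (g ⊗ h)) n          ≡⟨ shift-⊗ f (g ⊗ h) n ⟨
  (f ⊗ (g ⊗ h)) (suc n)                                  ∎
  where
  open +-*-Solver
  factor : ∀ a b c u v → a * b * c + (a * u + v) ≡ a * (b * c + u) + v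
  factor = solve 5 (λ a b c u v → a :* b :* c :+ (a :* u :+ v) := a :* (b :* c :+ u) :+ v) refl

⊗-comm : ∀ f g → f ⊗ g ≈ g ⊗ f
⊗-comm f g zero = begin
  (f ⊗ g) 0     ≡⟨ ⊗-coeff-zero f g ⟩
  f 0 * g 0     ≡⟨ ℤ.*-comm (f 0) (g 0) ⟩
  g 0 * f 0     ≡⟨ ⊗-coeff-zero g f ⟨
  (g ⊗ f) 0     ∎
⊗-comm f g (suc zero) = begin
  (f ⊗ g) 1                        ≡⟨ shift-⊗ f g 0 ⟩
  f 0 * g 1 + (shift f ⊗ g) 0      ≡⟨ cong (_+_ (f 0 * g 1)) (⊗-coeff-zero (shift f) g) ⟩
  f 0 * g 1 + f 1 * g 0            ≡⟨ swap (f 0) (g 1) (f 1) (g 0) ⟩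
  g 0 * f 1 + g 1 * f 0            ≡⟨ cong (_+_ (g 0 * f 1)) (⊗-coeff-zero (shift g) f) ⟨
  g 0 * f 1 + (shift g ⊗ f) 0      ≡⟨ shift-⊗ g f 0 ⟨
  (g ⊗ f) 1                        ∎
  where
  open +-*-Solver
  swap : ∀ a b c d → a * b + c * d ≡ d * c + b * a
  swap = solve 4 (λ a b c d → a :* b :+ c :* d := d :* c :+ b :* a) refl
⊗-comm f g (suc (suc n)) = begin
  (f ⊗ g) (2+ n)                                  ≡⟨ shift-⊗ f g (suc n) ⟩
  f 0 * g (2+ n) + (shift f ⊗ g) (suc n)          ≡⟨ cong (_+_ (f 0 * g (2+ n))) (⊗-comm (shift f) g (suc n)) ⟩
  f 0 * g (2+ n) + (g ⊗ shift f) (suc n)          ≡⟨ cong (_+_ (f 0 * g (2+ n))) (shift-⊗ g (shift f) n) ⟩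
  f 0 * g (2+ n) + (g 0 * f (2+ n) + (shift g ⊗ shift f) n)
                                                  ≡⟨ cong (λ u → f 0 * g (2+ n) + (g 0 * f (2+ n) + u)) (⊗-comm (shift g) (shift f) n) ⟩
  f 0 * g (2+ n) + (g 0 * f (2+ n) + (shift f ⊗ shift g) n)
                                                  ≡⟨ exchange (f 0 * g (2+ n)) (g 0 * f (2+ n)) _ ⟩
  g 0 * f (2+ n) + (f 0 * g (2+ n) + (shift f ⊗ shift g) n)
                                                  ≡⟨ cong (_+_ (g 0 * f (2+ n))) (shift-⊗ f (shift g) n) ⟨
  g 0 * f (2+ n) + (f ⊗ shift g) (suc n)          ≡⟨ cong (_+_ (g 0 * f (2+ n))) (⊗-comm (shift g) f (suc n)) ⟨
  g 0 * f (2+ n) + (shift g ⊗ f) (suc n)          ≡⟨ shift-⊗ g f (suc n) ⟨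
  (g ⊗ f) (2+ n)                                  ∎
  where
  open +-*-Solver
  exchange : ∀ a b u → a + (b + u) ≡ b + (a + u)
  exchange = solve 3 (λ a b u → a :+ (b :+ u) := b :+ (a :+ u)) refl

⊕-⊗-isCommutativeRing : IsCommutativeRing _≈_ _⊕_ _⊗_ ⊝_ 0ₚ 𝟙
⊕-⊗-isCommutativeRing = record
  { isRing = record
    { +-isAbelianGroup = record
      { isGroup = record
        { isMonoid = record
          { isSemigroup = record
            { isMagma = record
              { isEquivalence = ≈-isEquivalence
              ; ∙-cong        = λ f≈f′ g≈g′ n → cong₂ _+_ (f≈f′ n) (g≈g′ n)
              }
            ; assoc = λ f g h n → ℤ.+-assoc (f n) (g n) (h n)
            }
          ; identity = (λ f n → ℤ.+-identityˡ (f n)) , (λ f n → ℤ.+-identityʳ (f n))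
          }
        ; inverse = (λ f n → ℤ.+-inverseˡ (f n)) , (λ f n → ℤ.+-inverseʳ (f n))
        ; ⁻¹-cong = λ f≈g n → cong -_ (f≈g n)
        }
      ; comm = λ f g n → ℤ.+-comm (f n) (g n)
      }
    ; *-cong     = ⊗-cong
    ; *-assoc    = ⊗-assoc
    ; *-identity = ⊗-identityˡ , (λ f n → trans (⊗-comm f 𝟙 n) (⊗-identityˡ f n))
    ; distrib    = (λ f g h n → begin
                      (f ⊗ (g ⊕ h)) n          ≡⟨ ⊗-comm f (g ⊕ h) n ⟩
                      ((g ⊕ h) ⊗ f) n          ≡⟨ ⊗-distribʳ g h f n ⟩
                      (g ⊗ f) n + (h ⊗ f) n    ≡⟨ cong₂ _+_ (⊗-comm g f n) (⊗-comm h f n) ⟩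
                      (f ⊗ g) n + (f ⊗ h) n    ∎)
                 , (λ f g h → ⊗-distribʳ g h f)
    }
  ; *-comm = ⊗-comm
  }
  where
  ≈-isEquivalence : IsEquivalence _≈_
  ≈-isEquivalence = record
    { refl  = λ _ → refl
    ; sym   = λ f≈g n → sym (f≈g n)
    ; trans = λ f≈g g≈h n → trans (f≈g n) (g≈h n)
    }

⊕-⊗-commutativeRing : CommutativeRing 0ℓ 0ℓ
⊕-⊗-commutativeRing = record { isCommutativeRing = ⊕-⊗-isCommutativeRing }

module PS = CommutativeRing ⊕-⊗-commutativeRing
open import Algebra.Properties.Monoid PS.*-monoid using (cancelˡ; insertˡ)
open import Algebra.Properties.Semiring.Exp PS.semiring using (_^_)

Invertible : PS → Set
Invertible f = f 0 * f 0 ≡ + 1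

sum1-cong : ∀ m {h h′ : ℕ → ℤ} → (∀ j → h (suc j) ≡ h′ (suc j)) → sum1 m h ≡ sum1 m h′
sum1-cong zero    h≗h′ = refl
sum1-cong (suc m) h≗h′ = cong₂ _+_ (sum1-cong m h≗h′) (h≗h′ m)

invUpTo-stable : ∀ f {n k} → k ℕ.≤ n → invUpTo f n k ≡ inv f k
invUpTo-stable f {zero}  z≤n = refl
invUpTo-stable f {suc n} k≤1+n with ℕ.m≤n⇒m<n∨m≡n k≤1+n
... | inj₂ refl        = refl
... | inj₁ (s≤s k≤n) rewrite Equivalence.to T-≡ (ℕ.≤⇒≤ᵇ k≤n) = invUpTo-stable f k≤n

n<ᵇn≡false : ∀ n → (n <ᵇ n) ≡ false
n<ᵇn≡false zero    = refl
n<ᵇn≡false (suc n) = n<ᵇn≡false n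

inv-suc : ∀ f n → inv f (suc n) ≡ - (f 0 * sum1 (suc n) (λ j → f j * inv f (suc n ∸ j)))
inv-suc f n rewrite n<ᵇn≡false n =
  cong (λ s → - (f 0 * s)) (sum1-cong (suc n) (λ j → cong (f (suc j) *_) (invUpTo-stable f (ℕ.m∸n≤m n j))))

⊗-inverseʳ : ∀ f → Invertible f → f ⊗ inv f ≈ 𝟙
⊗-inverseʳ f f-inv zero    = trans (⊗-coeff-zero f (inv f)) f-inv
⊗-inverseʳ f f-inv (suc n) = begin
  f 0 * inv f (suc n) + Σ             ≡⟨ cong (λ i → f 0 * i + Σ) (inv-suc f n) ⟩
  f 0 * - (f 0 * Σ) + Σ               ≡⟨ cong (_+ Σ) (regroup (f 0) Σ) ⟩
  - (f 0 * f 0 * Σ) + Σ               ≡⟨ cong (λ u → - (u * Σ) + Σ) f-inv ⟩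
  - (+ 1 * Σ) + Σ                     ≡⟨ cong (λ u → - u + Σ) (ℤ.*-identityˡ Σ) ⟩
  - Σ + Σ                             ≡⟨ ℤ.+-inverseˡ Σ ⟩
  + 0                                 ∎
  where
  open +-*-Solver
  Σ : ℤ
  Σ = sum1 (suc n) (λ j → f j * inv f (suc n ∸ j))
  regroup : ∀ a s → a * - (a * s) ≡ - (a * a * s)
  regroup = solve 2 (λ a s → a :* (:- (a :* s)) := :- (a :* a :* s)) refl

⊗-cancelˡ : ∀ f {g h} → Invertible f → f ⊗ g ≈ f ⊗ h → g ≈ h
⊗-cancelˡ f {g} {h} f-inv fg≈fh =
  PS.trans (insertˡ {inv f} {f} inv-f⊗f≈𝟙 g)
           (PS.trans (PS.*-congˡ {inv f} fg≈fh) (cancelˡ {inv f} {f} inv-f⊗f≈𝟙 h))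
  where
  inv-f⊗f≈𝟙 : inv f ⊗ f ≈ 𝟙
  inv-f⊗f≈𝟙 = PS.trans (PS.*-comm (inv f) f) (⊗-inverseʳ f f-inv)

const-morphism : ℤ.+-*-rawRing -Raw-AlmostCommutative⟶ fromCommutativeRing ⊕-⊗-commutativeRing
const-morphism = record
  { ⟦_⟧    = const
  ; +-homo = +-homo
  ; *-homo = *-homo
  ; -‿homo = -‿homo
  ; 0-homo = λ { zero → refl ; (suc n) → refl }
  ; 1-homo = λ _ → refl
  }
  where
  +-homo : ∀ a b → const (a + b) ≈ const a ⊕ const b
  +-homo a b zero    = refl
  +-homo a b (suc n) = refl
  -‿homo : ∀ a → const (- a) ≈ ⊝ const a
  -‿homo a zero    = refl
  -‿homo a (suc n) = refl
  *-homo : ∀ a b → const (a * b) ≈ const a ⊗ const b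
  *-homo a b zero    = sym (⊗-coeff-zero (const a) (const b))
  *-homo a b (suc n) = sym (begin
    (const a ⊗ const b) (suc n)                        ≡⟨ shift-⊗ (const a) (const b) n ⟩
    a * + 0 + (shift (const a) ⊗ const b) n            ≡⟨ cong₂ _+_ (ℤ.*-zeroʳ a) (⊗-zeroˡ (λ _ → refl) (const b) n) ⟩
    + 0                                                ∎)

const-≟ : WeaklyDecidable (Induced-equivalence const-morphism)
const-≟ a b = Maybe.map (λ a≡b n → cong (λ c → const c n) a≡b) (dec⇒maybe (a ℤ.≟ b))

module PS-Solver = RingSolver ℤ.+-*-rawRing (fromCommutativeRing ⊕-⊗-commutativeRing) const-morphism const-≟

open PS-Solver using (Polynomial; Env; ⟦_⟧; ⟦_⟧N; correct; con; var; _:+_; _:*_; _:-_; _:^_; _:=_; solve; normalise)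

f⊗g≈h⇒g≈h⊘f : ∀ f {g h} → Invertible f → f ⊗ g ≈ h → g ≈ h ⊘ f
f⊗g≈h⇒g≈h⊘f f {g} {h} f-inv fg≈h = ⊗-cancelˡ f f-inv λ n → begin
  (f ⊗ g) n                 ≡⟨ fg≈h n ⟩
  h n                       ≡⟨ PS.*-identityʳ h n ⟨
  (h ⊗ 𝟙) n                 ≡⟨ ⊗-cong {h} PS.refl (⊗-inverseʳ f f-inv) n ⟨
  (h ⊗ (f ⊗ inv f)) n       ≡⟨ solve 3 (λ f h y → h :* (f :* y) := f :* (h :* y)) PS.refl f h (inv f) n ⟩
  (f ⊗ (h ⊗ inv f)) n       ∎

v⊗d≈n⇒x⊗n≈d⇒v⊗x≈𝟙 : ∀ {v} d {n x} → Invertible d → v ⊗ d ≈ n → x ⊗ n ≈ d → v ⊗ x ≈ 𝟙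
v⊗d≈n⇒x⊗n≈d⇒v⊗x≈𝟙 {v} d {n} {x} d-inv vd≈n xn≈d = ⊗-cancelˡ d d-inv λ i → begin
  (d ⊗ (v ⊗ x)) i      ≡⟨ solve 3 (λ d v x → d :* (v :* x) := x :* (v :* d)) PS.refl d v x i ⟩
  (x ⊗ (v ⊗ d)) i      ≡⟨ ⊗-cong {x} PS.refl vd≈n i ⟩
  (x ⊗ n) i            ≡⟨ xn≈d i ⟩
  d i                  ≡⟨ PS.*-identityʳ d i ⟨
  (d ⊗ 𝟙) i            ∎

h≈0⇒f⊕g⊗h≈f : ∀ f g {h} → h ≈ 0ₚ → f ⊕ g ⊗ h ≈ f
h≈0⇒f⊕g⊗h≈f f g h≈0 = PS.trans (PS.+-congˡ {f} (PS.trans (PS.*-congˡ {g} h≈0) (PS.zeroʳ g))) (PS.+-identityʳ f)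

shift-qpow1-⊗ : ∀ f → shift (qpow 1 ⊗ f) ≈ f
shift-qpow1-⊗ f n = begin
  (qpow 1 ⊗ f) (suc n)                     ≡⟨ shift-⊗ (qpow 1) f n ⟩
  + 0 * f (suc n) + (shift (qpow 1) ⊗ f) n ≡⟨ ℤ.+-identityˡ _ ⟩
  (shift (qpow 1) ⊗ f) n                   ≡⟨ ⊗-cong {g = f} shift-qpow1≈𝟙 PS.refl n ⟩
  (𝟙 ⊗ f) n                                ≡⟨ ⊗-identityˡ f n ⟩
  f n                                      ∎
  where
  shift-qpow1≈𝟙 : shift (qpow 1) ≈ 𝟙
  shift-qpow1≈𝟙 zero    = refl
  shift-qpow1≈𝟙 (suc n) = refl

qpow-suc : ∀ k → qpow (suc k) ≈ qpow 1 ⊗ qpow k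
qpow-suc k zero    = refl
qpow-suc k (suc n) = sym (shift-qpow1-⊗ (qpow k) n)

qpow≈^ : ∀ k → qpow k ≈ qpow 1 ^ k
qpow≈^ zero    = λ { zero → refl ; (suc n) → refl }
qpow≈^ (suc k) = PS.trans (qpow-suc k) (PS.*-congˡ {qpow 1} (qpow≈^ k))

≈-const⊕qpow1⊗shift : ∀ f → f ≈ const (f 0) ⊕ qpow 1 ⊗ shift f
≈-const⊕qpow1⊗shift f zero    = sym (ℤ.+-identityʳ (f 0))
≈-const⊕qpow1⊗shift f (suc n) = sym (trans (ℤ.+-identityˡ _) (shift-qpow1-⊗ (shift f) n))

const⊕qpow1⊗f≈const⇒f≈0 : ∀ c f → const c ⊕ qpow 1 ⊗ f ≈ const c → f ≈ 0ₚ
const⊕qpow1⊗f≈const⇒f≈0 c f e n = begin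
  f n                            ≡⟨ shift-qpow1-⊗ f n ⟨
  (qpow 1 ⊗ f) (suc n)           ≡⟨ ℤ.+-identityˡ _ ⟨
  + 0 + (qpow 1 ⊗ f) (suc n)     ≡⟨ e (suc n) ⟩
  + 0                            ∎

-- Continued fractions and their convergents

⊕-continuant : ∀ a c {y p d} → p ⊗ y ≈ d → (a ⊕ c ⊗ y) ⊗ p ≈ a ⊗ p ⊕ c ⊗ d
⊕-continuant a c {y} {p} py≈d =
  PS.trans (solve 4 (λ a c y p → (a :+ c :* y) :* p := a :* p :+ c :* (p :* y)) PS.refl a c y p)
           (PS.+-congˡ {a ⊗ p} (PS.*-congˡ {c} py≈d))

⊖-continuant : ∀ a c {y p d} → p ⊗ y ≈ d → (a ⊖ c ⊗ y) ⊗ p ≈ a ⊗ p ⊖ c ⊗ d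
⊖-continuant a c {y} {p} py≈d =
  PS.trans (solve 4 (λ a c y p → (a :- c :* y) :* p := a :* p :- c :* (p :* y)) PS.refl a c y p)
           (PS.+-congˡ {a ⊗ p} (PS.-‿cong (PS.*-congˡ {c} py≈d)))

infixr 5 _+_/_ _-_/_

data ContFrac (n : ℕ) : Set where
  ⌊_⌋   : Polynomial n → ContFrac n
  _+_/_ : Polynomial n → Polynomial n → ContFrac n → ContFrac n
  _-_/_ : Polynomial n → Polynomial n → ContFrac n → ContFrac n

module _ {n : ℕ} where

  value : ContFrac n → Env n → PS
  value ⌊ t ⌋       ρ = ⟦ t ⟧ ρ
  value (a + c / k) ρ = ⟦ a ⟧ ρ ⊕ ⟦ c ⟧ ρ ⊘ value k ρ
  value (a - c / k) ρ = ⟦ a ⟧ ρ ⊖ ⟦ c ⟧ ρ ⊘ value k ρ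

  numerator denominator : ContFrac n → Polynomial n
  numerator ⌊ t ⌋       = t
  numerator (a + c / k) = a :* numerator k :+ c :* denominator k
  numerator (a - c / k) = a :* numerator k :- c :* denominator k
  denominator ⌊ t ⌋       = con (+ 1)
  denominator (a + c / k) = numerator k
  denominator (a - c / k) = numerator k

  HasInvertibleTails : ContFrac n → Env n → Set
  HasInvertibleTails ⌊ t ⌋       ρ = ⊤
  HasInvertibleTails (a + c / k) ρ = Invertible (value k ρ) × HasInvertibleTails k ρ
  HasInvertibleTails (a - c / k) ρ = Invertible (value k ρ) × HasInvertibleTails k ρ

  numerator⊘value : ∀ k ρ → Invertible (value k ρ) → HasInvertibleTails k ρ →
    ⟦ numerator k ⟧ ρ ⊘ value k ρ ≈ ⟦ denominator k ⟧ ρ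

  value⊗denominator≈numerator : ∀ k ρ → HasInvertibleTails k ρ →
    value k ρ ⊗ ⟦ denominator k ⟧ ρ ≈ ⟦ numerator k ⟧ ρ
  value⊗denominator≈numerator ⌊ t ⌋       ρ _              = PS.*-identityʳ (⟦ t ⟧ ρ)
  value⊗denominator≈numerator (a + c / k) ρ (k-inv , tails) =
    ⊕-continuant (⟦ a ⟧ ρ) (⟦ c ⟧ ρ) (numerator⊘value k ρ k-inv tails)
  value⊗denominator≈numerator (a - c / k) ρ (k-inv , tails) =
    ⊖-continuant (⟦ a ⟧ ρ) (⟦ c ⟧ ρ) (numerator⊘value k ρ k-inv tails)

  numerator⊘value k ρ k-inv tails =
    PS.sym (f⊗g≈h⇒g≈h⊘f (value k ρ) k-inv (value⊗denominator≈numerator k ρ tails))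

-- Identities in q and x by normalisation

q x q² q³ q⁵ one two : Polynomial 5
q   = var zero
x   = var (suc zero)
q²  = var (suc (suc zero))
q³  = var (suc (suc (suc zero)))
q⁵  = var (suc (suc (suc (suc zero))))
one = con (+ 1)
two = con (+ 2)

-- The monomials q², q³, q⁵ are separate variables so that evaluating a polynomial
-- reproduces the literal qpow k of the statement.
env : PS → Env 5
env y = qpow 1 ∷ y ∷ qpow 2 ∷ qpow 3 ∷ qpow 5 ∷ []

atPowersOfQ : Polynomial 2 → Fin 5 → Polynomial 2
atPowersOfQ t zero                         = var zero
atPowersOfQ t (suc zero)                   = t
atPowersOfQ t (suc (suc zero))             = var zero :^ 2
atPowersOfQ t (suc (suc (suc zero)))       = var zero :^ 3
atPowersOfQ t (suc (suc (suc (suc zero)))) = var zero :^ 5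

open Substitution const-morphism const-≟

⟦⟧-atPowersOfQ : ∀ z {t y} → ⟦ t ⟧ (qpow 1 ∷ z ∷ []) ≈ y →
  ∀ p → ⟦ p [ atPowersOfQ t ] ⟧ (qpow 1 ∷ z ∷ []) ≈ ⟦ p ⟧ (env y)
⟦⟧-atPowersOfQ z t≈y = ⟦⟧-[] λ
  { zero                         → PS.refl
  ; (suc zero)                   → t≈y
  ; (suc (suc zero))             → PS.sym (qpow≈^ 2)
  ; (suc (suc (suc zero)))       → PS.sym (qpow≈^ 3)
  ; (suc (suc (suc (suc zero)))) → PS.sym (qpow≈^ 5)
  }

≈-by-normalisation : ∀ z s y p p′ → ⟦ s ⟧ (qpow 1 ∷ z ∷ []) ≈ y →
  normalise (p [ atPowersOfQ s ]) ≡ normalise (p′ [ atPowersOfQ (var (suc zero)) ]) →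
  ⟦ p ⟧ (env y) ≈ ⟦ p′ ⟧ (env z)
≈-by-normalisation z s y p p′ s≈y p≡p′ n = begin
  ⟦ p ⟧ (env y) n                                          ≡⟨ ⟦⟧-atPowersOfQ z s≈y p n ⟨
  ⟦ p [ atPowersOfQ s ] ⟧ ρ n                              ≡⟨ correct (p [ atPowersOfQ s ]) ρ n ⟨
  ⟦ normalise (p [ atPowersOfQ s ]) ⟧N ρ n                 ≡⟨ cong (λ nf → ⟦ nf ⟧N ρ n) p≡p′ ⟩
  ⟦ normalise (p′ [ atPowersOfQ (var (suc zero)) ]) ⟧N ρ n ≡⟨ correct (p′ [ atPowersOfQ (var (suc zero)) ]) ρ n ⟩
  ⟦ p′ [ atPowersOfQ (var (suc zero)) ] ⟧ ρ n              ≡⟨ ⟦⟧-atPowersOfQ z PS.refl p′ n ⟩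
  ⟦ p′ ⟧ (env z) n                                         ∎
  where
  ρ : Env 2
  ρ = qpow 1 ∷ z ∷ []

-- Holds by refl; instantiating it instead of unfolding ⟦ p₁ :* p₂ ⟧ keeps Agda from
-- evaluating a large p₂ coefficientwise.
⟦⟧-:* : ∀ {n} (p₁ p₂ : Polynomial n) ρ → ⟦ p₁ :* p₂ ⟧ ρ ≈ ⟦ p₁ ⟧ ρ ⊗ ⟦ p₂ ⟧ ρ
⟦⟧-:* p₁ p₂ ρ = PS.refl

-- With S in the x-slot, the left-hand side of the hypothesis.
S-equation : Polynomial 5
S-equation = q :* x :* x :+ (one :- two :* q :- q³) :* x

minimal : Polynomial 5
minimal = q² :* x :* x :+ (one :- q³) :* x :- one :- q²

-- The quotient of x · numerator cf - denominator cf by minimal.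
cofactor : Polynomial 5
cofactor = one :+ q :+ con (+ 8) :* q :^ 2 :+ con (+ 4) :* q :^ 3 :+ con (+ 21) :* q :^ 4
           :+ con (+ 3) :* q :^ 5 :+ con (+ 23) :* q :^ 6 :- q :^ 7 :+ con (+ 10) :* q :^ 8

cf : ContFrac 5
cf = one - q³ / one :+ two :* q² + q⁵ / one :+ two :* q² :- q³ + q⁵ / one :+ two :* q² - q³ /
     one + q² / one + q² / one :+ q + q² / ⌊ one :+ q² :* x ⌋

S-equation⇒minimal≈0 : ∀ S → ⟦ S-equation ⟧ (env S) ≈ 𝟙 → ⟦ minimal ⟧ (env (shift S)) ≈ 0ₚ
S-equation⇒minimal≈0 S H = const⊕qpow1⊗f≈const⇒f≈0 (+ 1) (⟦ minimal ⟧ (env (shift S)))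
  (PS.trans (PS.sym (≈-by-normalisation (shift S) (con (+ 1) :+ var zero :* var (suc zero)) S
                                        S-equation (one :+ q :* minimal) 1+q⊗shiftS≈S refl)) H)
  where
  S0≡1 : S 0 ≡ + 1
  S0≡1 = begin
    S 0                                                 ≡⟨ ℤ.*-identityˡ (S 0) ⟨
    + 1 * S 0                                           ≡⟨ ℤ.+-identityˡ _ ⟨
    (qpow 1 ⊗ S) 0 * S 0 + (𝟙 ⊖ const (+ 2) ⊗ qpow 1 ⊖ qpow 3) 0 * S 0
                                                        ≡⟨ cong₂ _+_ (⊗-coeff-zero (qpow 1 ⊗ S) S)
                                                                     (⊗-coeff-zero (𝟙 ⊖ const (+ 2) ⊗ qpow 1 ⊖ qpow 3) S) ⟨
    ⟦ S-equation ⟧ (env S) 0                            ≡⟨ H 0 ⟩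
    + 1                                                 ∎
  1+q⊗shiftS≈S : 𝟙 ⊕ qpow 1 ⊗ shift S ≈ S
  1+q⊗shiftS≈S = PS.sym (PS.trans (≈-const⊕qpow1⊗shift S) (PS.+-congʳ (λ n → cong (λ c → const c n) S0≡1)))

x⊗numerator≈denominator : ∀ z → ⟦ minimal ⟧ (env z) ≈ 0ₚ →
  z ⊗ ⟦ numerator cf ⟧ (env z) ≈ ⟦ denominator cf ⟧ (env z)
x⊗numerator≈denominator z minimal≈0 =
  PS.trans (PS.sym (⟦⟧-:* x (numerator cf) (env z))) (PS.trans
    (≈-by-normalisation z (var (suc zero)) z (x :* numerator cf) (denominator cf :+ cofactor :* minimal) PS.refl refl)
    (h≈0⇒f⊕g⊗h≈f (⟦ denominator cf ⟧ (env z)) (⟦ cofactor ⟧ (env z)) minimal≈0))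

lemma3p8 : (S : PS) →
    qpow 1 ⊗ S ⊗ S ⊕ (𝟙 ⊖ const (+ 2) ⊗ qpow 1 ⊖ qpow 3) ⊗ S ≈ 𝟙 →
    shift S ≈
      𝟙 ⊘ (𝟙 ⊖ qpow 3 ⊘ (𝟙 ⊕ const (+ 2) ⊗ qpow 2
        ⊕ qpow 5 ⊘ (𝟙 ⊕ const (+ 2) ⊗ qpow 2 ⊖ qpow 3
        ⊕ qpow 5 ⊘ (𝟙 ⊕ const (+ 2) ⊗ qpow 2
        ⊖ qpow 3 ⊘ (𝟙
        ⊕ qpow 2 ⊘ (𝟙
        ⊕ qpow 2 ⊘ (𝟙 ⊕ qpow 1
        ⊕ qpow 2 ⊘ (𝟙 ⊕ qpow 2 ⊗ shift S))))))))
lemma3p8 S H = f⊗g≈h⇒g≈h⊘f (value cf ρ) refl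
  -- Inferring these implicit arguments by unification would unfold the convergents.
  (v⊗d≈n⇒x⊗n≈d⇒v⊗x≈𝟙 {value cf ρ} (⟦ denominator cf ⟧ ρ) {⟦ numerator cf ⟧ ρ} {shift S} refl
    (value⊗denominator≈numerator cf ρ (refl , refl , refl , refl , refl , refl , refl , _))
    (x⊗numerator≈denominator (shift S) (S-equation⇒minimal≈0 S H)))
  where
  ρ : Env 5
  ρ = env (shift S)
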